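{- Let $w_n$ be the number of weak-ordering chains in $\mathcal{WOC}(n)$ subject to the stopping condition $x_i\le x_j$ with $i<j$ (i.e. a chain contains the stopping condition if there are indices $i<j$ with $x_i<x_j$ or $x_i=x_j$ in the chain). Then $w_n=n^2-n+1$ for all $n\ge 1$. The sequence starts $1,3,7,13,21,31,43,57,\dots$.
   Context: A weak-ordering chain on $x_1,\dots,x_m$ is an expression $x_{i_1}\,\mathrm{op}\,x_{i_2}\,\mathrm{op}\cdots\mathrm{op}\,x_{i_m}$, where $(i_1,\dots,i_m)$ is an ordering of $[m]=\{1,\dots,m\}$ and each $\mathrm{op}$ is $<$ or $=$; two expressions defining the same ordered set partition of $[m]$ (blocks = index sets of equal variables, ordered by increasing value) are identified. $\mathcal{WOC}(m)$ is the set of these chains. Each chain in $\mathcal{WOC}(m)$, $m\ge 2$, arises uniquely from its restriction to $x_1,\dots,x_{m-1}$ (a chain in $\mathcal{WOC}(m-1)$) by inserting $x_m$; this gives a rooted tree with root $x_1$ whose level-$m$ nodes are the elements of $\mathcal{WOC}(m)$. Given a stopping condition, the restricted generating tree of order $n$ is the part of this tree up to level $n$ in which any node whose chain contains the stopping condition has no descendants. Its leaves are the nodes at level $n$ together with the nodes containing the stopping condition. "The number of weak-ordering chains in $\mathcal{WOC}(n)$ subject to the stopping condition" means the number of leaves of this restricted tree of order $n$; equivalently, the number of chains in $\mathcal{WOC}(n)$ not containing the condition plus, for each $1\le j\le n$, the number of chains in $\mathcal{WOC}(j)$ that contain the condition while their restriction to $x_1,\dots,x_{j-1}$ does not. -}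

module Defs where

open import Data.Nat as ℕ using (ℕ; zero; suc; _<ᵇ_; _+_)
import Data.Nat.Properties as ℕP
open import Data.Fin as Fin using (Fin)
import Data.Fin.Properties as FinP
open import Data.Vec using (Vec; []; _∷_; _∷ʳ_; lookup)
import Data.Vec as Vec
open import Data.List using (List; []; _∷_; _++_; upTo)
import Data.List as List
open import Data.Product using (Σ; ∃; _×_; _,_)
open import Data.Bool using (if_then_else_)
open import Relation.Nullary using (Dec; yes; no)
open import Relation.Nullary.Decidable using (_×-dec_)

-- A weak-ordering chain on x_1,…,x_m (an ordered set partition of [m]) is
-- represented by its number k of blocks together with the rank vector
-- v : Vec ℕ m, where lookup v i ∈ {0,…,k-1} is the position of the block
-- containing x_{i+1} (blocks ordered by increasing value).  Every block is
-- nonempty, i.e. the ranks are onto {0,…,k-1}; this is guaranteed since all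
-- chains below are generated from the root by insertion.
Chain : ℕ → Set
Chain m = ℕ × Vec ℕ m

root : Chain 1
root = 1 , 0 ∷ []

shift : ℕ → ℕ → ℕ
shift g r = if r <ᵇ g then r else suc r

-- Children in the generating tree: all ways of inserting x_{m+1}:
-- either x_{m+1} = (an existing block r), r < k,
-- or x_{m+1} forms a new singleton block at gap g, g ≤ k.
children : ∀ {m} → Chain m → List (Chain (suc m))
children (k , v) =
  List.map (λ r → k , v ∷ʳ r) (upTo k)
  ++ List.map (λ g → suc k , Vec.map (shift g) v ∷ʳ g) (upTo (suc k))

ContainsCond : ∀ {m} → Chain m → Set
ContainsCond {m} (k , v) =
  ∃ λ (i : Fin m) → ∃ λ (j : Fin m) → (i Fin.< j) × (lookup v i ℕ.≤ lookup v j)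

containsCond? : ∀ {m} (c : Chain m) → Dec (ContainsCond c)
containsCond? (k , v) =
  FinP.any? (λ i → FinP.any? (λ j → (i FinP.<? j) ×-dec (lookup v i ℕP.≤? lookup v j)))

-- Number of leaves of the restricted generating tree below a node,
-- with d further levels still allowed.
mutual
  leaves : ∀ {m} → ℕ → Chain m → ℕ
  leaves d c with containsCond? c
  ... | yes _ = 1
  leaves zero    c | no _ = 1
  leaves (suc d) c | no _ = leavesList d (children c)

  leavesList : ∀ {m} → ℕ → List (Chain m) → ℕ
  leavesList d []       = 0
  leavesList d (c ∷ cs) = leaves d c + leavesList d cs

-- w n : number of leaves of the restricted generating tree of order n
-- (root at level 1, leaves at level n or at nodes containing the condition).
w : ℕ → ℕ
w n = leaves (n ℕ.∸ 1) root

{-# OPTIONS --safe #-}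
-- The only chain on x_1,…,x_m avoiding the condition is the strictly
-- decreasing one x_1 > x_2 > ⋯ > x_m.  Of its 2m + 1 children, the m with
-- x_{m+1} equal to some x_i and the m with x_{m+1} in a new block just above
-- some x_i contain the condition, so they are leaves; only x_{m+1} below
-- everything continues.  The tree is thus a spine shedding 2m leaves at level
-- m + 1, and w_n = 1 + Σ_{m<n} 2m = n² − n + 1.
module Submission where

open import Defs
open import Data.Nat using (ℕ; _≤_; _*_; _∸_; _+_)
open import Relation.Binary.PropositionalEquality using (_≡_)

open import Data.Nat using (zero; suc; _<_; _<ᵇ_; z≤n; s≤s)
import Data.Nat.Properties as ℕP
open import Data.Nat.Tactic.RingSolver using (solve-∀)
open import Data.Fin as Fin using (Fin; inject₁; fromℕ)
open import Data.Vec as Vec using (Vec; []; _∷_; _∷ʳ_; lookup)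
open import Data.Vec.Properties using (lookup-map)
open import Data.List as List using (List; []; _∷_; _++_; applyUpTo; length)
open import Data.List.Properties using (length-map; length-applyUpTo)
open import Data.List.Relation.Unary.All using (All; []; _∷_)
open import Data.List.Relation.Unary.All.Properties using (map⁺; applyUpTo⁺₁)
open import Data.Product using (∃; _,_)
open import Data.Bool using (true)
open import Data.Empty using (⊥-elim)
open import Relation.Nullary using (¬_; yes; no)
open import Relation.Binary.PropositionalEquality
  using (refl; sym; trans; cong; cong₂; subst₂; module ≡-Reasoning)

descending : (m : ℕ) → Vec ℕ m
descending zero    = []
descending (suc m) = m ∷ descending m

descendingChain : (m : ℕ) → Chain m
descendingChain m = m , descending m

lookup-descending< : ∀ m (i : Fin m) → lookup (descending m) i < m
lookup-descending< (suc m) Fin.zero    = ℕP.≤-refl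
lookup-descending< (suc m) (Fin.suc i) = ℕP.m≤n⇒m≤1+n (lookup-descending< m i)

descending-strictlyDecreasing : ∀ m {i j : Fin m} → i Fin.< j →
                                lookup (descending m) j < lookup (descending m) i
descending-strictlyDecreasing (suc m) {Fin.zero}  {Fin.suc j} _       = lookup-descending< m j
descending-strictlyDecreasing (suc m) {Fin.suc i} {Fin.suc j} (s≤s p) =
  descending-strictlyDecreasing m p

descending-surjective : ∀ m {r} → r < m → ∃ λ (i : Fin m) → lookup (descending m) i ≡ r
descending-surjective (suc m) {r} r<1+m with r ℕP.≟ m
... | yes r≡m = Fin.zero , sym r≡m
... | no  r≢m with descending-surjective m (ℕP.≤∧≢⇒< (ℕP.≤-pred r<1+m) r≢m)
...   | i , eq = Fin.suc i , eq

descendingChain-avoidsCond : ∀ m → ¬ ContainsCond (descendingChain m)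
descendingChain-avoidsCond m (i , j , i<j , vi≤vj) =
  ℕP.<⇒≱ (descending-strictlyDecreasing m i<j) vi≤vj

lookup-∷ʳ-inject₁ : ∀ {m} (v : Vec ℕ m) x (i : Fin m) → lookup (v ∷ʳ x) (inject₁ i) ≡ lookup v i
lookup-∷ʳ-inject₁ (_ ∷ v) x Fin.zero    = refl
lookup-∷ʳ-inject₁ (_ ∷ v) x (Fin.suc i) = lookup-∷ʳ-inject₁ v x i

lookup-∷ʳ-fromℕ : ∀ {m} (v : Vec ℕ m) x → lookup (v ∷ʳ x) (fromℕ m) ≡ x
lookup-∷ʳ-fromℕ []      x = refl
lookup-∷ʳ-fromℕ (_ ∷ v) x = lookup-∷ʳ-fromℕ v x

inject₁<fromℕ : ∀ {m} (i : Fin m) → inject₁ i Fin.< fromℕ m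
inject₁<fromℕ Fin.zero    = s≤s z≤n
inject₁<fromℕ (Fin.suc i) = s≤s (inject₁<fromℕ i)

∷ʳ-containsCond : ∀ {m} k (v : Vec ℕ m) {x} (i : Fin m) → lookup v i ≤ x →
                  ContainsCond (k , v ∷ʳ x)
∷ʳ-containsCond {m} k v {x} i vi≤x =
  inject₁ i , fromℕ m , inject₁<fromℕ i ,
  subst₂ _≤_ (sym (lookup-∷ʳ-inject₁ v x i)) (sym (lookup-∷ʳ-fromℕ v x)) vi≤x

shift-below : ∀ {r g} → r < g → shift g r ≡ r
shift-below {r} {g} r<g with r <ᵇ g | ℕP.<⇒<ᵇ r<g
... | true | _ = refl

descending-shift-zero : ∀ m → Vec.map (shift 0) (descending m) ∷ʳ 0 ≡ descending (suc m)
descending-shift-zero zero    = refl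
descending-shift-zero (suc m) = cong (suc m ∷_) (descending-shift-zero m)

descending-∷ʳ-containsCond : ∀ m {r} → r < m → ContainsCond (m , descending m ∷ʳ r)
descending-∷ʳ-containsCond m r<m with descending-surjective m r<m
... | i , vi≡r = ∷ʳ-containsCond m (descending m) i (ℕP.≤-reflexive vi≡r)

-- Shifting at suc g leaves block g in place, directly below the new block.
descending-newBlock-containsCond :
  ∀ m {g} → g < m → ContainsCond (suc m , Vec.map (shift (suc g)) (descending m) ∷ʳ suc g)
descending-newBlock-containsCond m {g} g<m with descending-surjective m g<m
... | i , vi≡g = ∷ʳ-containsCond (suc m) (Vec.map (shift (suc g)) (descending m)) i
    (ℕP.≤-trans (ℕP.≤-reflexive shifted-vi≡g) (ℕP.n≤1+n g))
  where
  open ≡-Reasoning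
  shifted-vi≡g : lookup (Vec.map (shift (suc g)) (descending m)) i ≡ g
  shifted-vi≡g = begin
    lookup (Vec.map (shift (suc g)) (descending m)) i ≡⟨ lookup-map i (shift (suc g)) (descending m) ⟩
    shift (suc g) (lookup (descending m) i)           ≡⟨ cong (shift (suc g)) vi≡g ⟩
    shift (suc g) g                                   ≡⟨ shift-below (ℕP.n<1+n g) ⟩
    g                                                 ∎

leaves-stopped : ∀ {m} d (c : Chain m) → ContainsCond c → leaves d c ≡ 1
leaves-stopped d c p with containsCond? c
... | yes _  = refl
... | no ¬p = ⊥-elim (¬p p)

leaves-zero : ∀ {m} (c : Chain m) → leaves zero c ≡ 1
leaves-zero c with containsCond? c
... | yes _ = refl
... | no  _ = refl

leaves-suc-free : ∀ {m} d (c : Chain m) → ¬ ContainsCond c →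
                  leaves (suc d) c ≡ leavesList d (children c)
leaves-suc-free d c ¬p with containsCond? c
... | yes p = ⊥-elim (¬p p)
... | no  _ = refl

leavesList-++ : ∀ {m} d (cs cs′ : List (Chain m)) →
                leavesList d (cs ++ cs′) ≡ leavesList d cs + leavesList d cs′
leavesList-++ d []       cs′ = refl
leavesList-++ d (c ∷ cs) cs′ =
  trans (cong (leaves d c +_) (leavesList-++ d cs cs′)) (sym (ℕP.+-assoc (leaves d c) _ _))

leavesList-stopped : ∀ {m} d {cs : List (Chain m)} → All ContainsCond cs → leavesList d cs ≡ length cs
leavesList-stopped d {c ∷ _} (p ∷ ps) = cong₂ _+_ (leaves-stopped d c p) (leavesList-stopped d ps)
leavesList-stopped d []               = refl

leavesList-applyUpTo-stopped : ∀ {m} d (f : ℕ → Chain m) h n →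
                               (∀ {i} → i < n → ContainsCond (f (h i))) →
                               leavesList d (List.map f (applyUpTo h n)) ≡ n
leavesList-applyUpTo-stopped d f h n stop = begin
  leavesList d (List.map f (applyUpTo h n)) ≡⟨ leavesList-stopped d (map⁺ (applyUpTo⁺₁ h n stop)) ⟩
  length (List.map f (applyUpTo h n))       ≡⟨ length-map f (applyUpTo h n) ⟩
  length (applyUpTo h n)                    ≡⟨ length-applyUpTo h n ⟩
  n                                         ∎
  where open ≡-Reasoning

-- upTo (suc m) unfolds to 0 ∷ applyUpTo suc m, separating the one continuing child.
leaves-descendingChain-suc : ∀ m d →
  leaves (suc d) (descendingChain m) ≡ m + (leaves d (descendingChain (suc m)) + m)
leaves-descendingChain-suc m d = begin
  leaves (suc d) (descendingChain m)
    ≡⟨ leaves-suc-free d (descendingChain m) (descendingChain-avoidsCond m) ⟩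
  leavesList d (equalChildren ++ newBlockChildren)
    ≡⟨ leavesList-++ d equalChildren newBlockChildren ⟩
  leavesList d equalChildren
    + (leaves d (suc m , Vec.map (shift 0) (descending m) ∷ʳ 0)
       + leavesList d (List.map newBlock (applyUpTo suc m)))
    ≡⟨ cong₂ _+_ (leavesList-applyUpTo-stopped d equal (λ r → r) m (descending-∷ʳ-containsCond m))
                 (cong₂ _+_ (cong (λ v → leaves d (suc m , v)) (descending-shift-zero m))
                            (leavesList-applyUpTo-stopped d newBlock suc m
                               (descending-newBlock-containsCond m))) ⟩
  m + (leaves d (descendingChain (suc m)) + m)
    ∎
  where
  open ≡-Reasoning
  equal : ℕ → Chain (suc m)
  equal r = m , descending m ∷ʳ r
  newBlock : ℕ → Chain (suc m)
  newBlock g = suc m , Vec.map (shift g) (descending m) ∷ʳ g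
  equalChildren newBlockChildren : List (Chain (suc m))
  equalChildren    = List.map equal (List.upTo m)
  newBlockChildren = List.map newBlock (List.upTo (suc m))

leaves-descendingChain : ∀ m d → leaves d (descendingChain (suc m)) ≡ 1 + d * (2 * m + d + 1)
leaves-descendingChain m zero    = leaves-zero (descendingChain (suc m))
leaves-descendingChain m (suc d) = begin
  leaves (suc d) (descendingChain (suc m))
    ≡⟨ leaves-descendingChain-suc (suc m) d ⟩
  suc m + (leaves d (descendingChain (suc (suc m))) + suc m)
    ≡⟨ cong (λ l → suc m + (l + suc m)) (leaves-descendingChain (suc m) d) ⟩
  suc m + ((1 + d * (2 * suc m + d + 1)) + suc m)
    ≡⟨ closedForm-step m d ⟩
  1 + suc d * (2 * m + suc d + 1)
    ∎
  where
  open ≡-Reasoning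
  closedForm-step : ∀ m d → suc m + ((1 + d * (2 * suc m + d + 1)) + suc m) ≡ 1 + suc d * (2 * m + suc d + 1)
  closedForm-step = solve-∀

theorem3 : ∀ (n : ℕ) → 1 ≤ n → w n ≡ n * n ∸ n + 1
theorem3 (suc n) _ = begin
  leaves n (descendingChain 1)   ≡⟨ leaves-descendingChain 0 n ⟩
  1 + n * (n + 1)                ≡⟨ ℕP.+-comm 1 (n * (n + 1)) ⟩
  n * (n + 1) + 1                ≡⟨ cong (λ k → n * k + 1) (ℕP.+-comm n 1) ⟩
  n * suc n + 1                  ≡⟨ cong (_+ 1) (sym (ℕP.m+n∸m≡n (suc n) (n * suc n))) ⟩
  suc n * suc n ∸ suc n + 1      ∎
  where open ≡-Reasoning
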